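{- The Karoubi envelope $\mathrm{Split}(\mathsf{JLat_{JApp}})$ is dually equivalent to the category $\mathsf{ContLat}$ of continuous lattices and suplattice homomorphisms.
   Context: Work constructively. An ideal of a poset is a downward closed, inhabited, upward directed subset. For join-semilattices $(S,0,\vee)$ and $(S',0',\vee')$, a relation $r\subseteq S\times S'$ is approximable if $\{a\mid a\,r\,b\}$ is an ideal for each $b\in S'$ and $\{b\mid a\,r\,b\}$ is upward closed for each $a\in S$; it is join-approximable if moreover $a\,r\,0'\Rightarrow a=0$ and $a\,r\,(b\vee'c)\Rightarrow\exists b',c'\in S\,(a\le b'\vee c'\ \&\ b'\,r\,b\ \&\ c'\,r\,c)$. $\mathsf{JLat_{JApp}}$ is the category of join-semilattices and join-approximable relations, with identity $\le$ and relational composition. The Karoubi envelope $\mathrm{Split}(\mathcal C)$ has objects the idempotents $f:A\to A$ of $\mathcal C$ and morphisms $(f:A\to A)\to(g:B\to B)$ the $h:A\to B$ with $g\circ h=h=h\circ f$. A continuous lattice is a continuous domain with finite joins; a suplattice homomorphism is a function preserving all joins. Dually equivalent means equivalent to the opposite category. -}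

module Defs where

open import Level using (Level; _⊔_; 0ℓ) renaming (suc to lsuc)
open import Data.Product using (Σ; ∃; _×_; _,_; proj₁; proj₂)
open import Function using (_∘′_)
open import Relation.Binary.Bundles using (Poset)
open import Relation.Binary.Lattice.Bundles using (BoundedJoinSemilattice)

record CatStr (o h e : Level) : Set (lsuc (o ⊔ h ⊔ e)) where
  infixr 9 _∘_
  infix 4 _≈_
  field
    Obj : Set o
    Hom : Obj → Obj → Set h
    _≈_ : ∀ {A B} → Hom A B → Hom A B → Set e
    id  : ∀ {A} → Hom A A
    _∘_ : ∀ {A B C} → Hom B C → Hom A B → Hom A C

Op : ∀ {o h e} → CatStr o h e → CatStr o h e
Op C = record
  { Obj = Obj ; Hom = λ A B → Hom B A ; _≈_ = _≈_ ; id = id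
  ; _∘_ = λ g f → f ∘ g }
  where open CatStr C

record Functor {o h e o′ h′ e′} (C : CatStr o h e) (D : CatStr o′ h′ e′)
       : Set (o ⊔ h ⊔ e ⊔ o′ ⊔ h′ ⊔ e′) where
  private
    module C = CatStr C
    module D = CatStr D
  field
    F₀       : C.Obj → D.Obj
    F₁       : ∀ {A B} → C.Hom A B → D.Hom (F₀ A) (F₀ B)
    F-resp-≈ : ∀ {A B} {f g : C.Hom A B} → f C.≈ g → F₁ f D.≈ F₁ g
    F-id     : ∀ {A} → F₁ (C.id {A}) D.≈ D.id
    F-∘      : ∀ {A B C′} (g : C.Hom B C′) (f : C.Hom A B) →
               F₁ (g C.∘ f) D.≈ (F₁ g D.∘ F₁ f)

record CompIsoId {o h e o′ h′ e′} {C : CatStr o h e} {D : CatStr o′ h′ e′}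
       (F : Functor C D) (G : Functor D C) : Set (o ⊔ h ⊔ e) where
  private
    module C = CatStr C
    module F = Functor F
    module G = Functor G
  field
    η       : ∀ A → C.Hom (G.F₀ (F.F₀ A)) A
    η⁻¹     : ∀ A → C.Hom A (G.F₀ (F.F₀ A))
    iso₁    : ∀ A → (η A C.∘ η⁻¹ A) C.≈ C.id
    iso₂    : ∀ A → (η⁻¹ A C.∘ η A) C.≈ C.id
    natural : ∀ {A B} (f : C.Hom A B) →
              (f C.∘ η A) C.≈ (η B C.∘ G.F₁ (F.F₁ f))

record Equivalence {o h e o′ h′ e′} (C : CatStr o h e) (D : CatStr o′ h′ e′)
       : Set (o ⊔ h ⊔ e ⊔ o′ ⊔ h′ ⊔ e′) where
  field
    F     : Functor C D
    G     : Functor D C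
    unit  : CompIsoId F G
    count : CompIsoId G F

record Idem {o h e} (C : CatStr o h e) : Set (o ⊔ h ⊔ e) where
  open CatStr C
  field
    obj  : Obj
    idem : Hom obj obj
    idem-∘ : (idem ∘ idem) ≈ idem

record SplitHom {o h e} (C : CatStr o h e) (X Y : Idem C) : Set (h ⊔ e) where
  open CatStr C
  private
    module X = Idem X
    module Y = Idem Y
  field
    mor  : Hom X.obj Y.obj
    left  : (Y.idem ∘ mor) ≈ mor
    right : (mor ∘ X.idem) ≈ mor

-- The Karoubi envelope needs (only) that ≈ is an equivalence, that ∘ is
-- associative and a congruence; these are supplied as arguments.
module _ {o h e} (C : CatStr o h e) where
  open CatStr C
  record CatLaws : Set (o ⊔ h ⊔ e) where
    field
      ≈-sym   : ∀ {A B} {f g : Hom A B} → f ≈ g → g ≈ f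
      ≈-trans : ∀ {A B} {f g k : Hom A B} → f ≈ g → g ≈ k → f ≈ k
      assoc   : ∀ {A B C′ D} (k : Hom C′ D) (g : Hom B C′) (f : Hom A B) →
                ((k ∘ g) ∘ f) ≈ (k ∘ (g ∘ f))
      ∘-cong  : ∀ {A B C′} {g g′ : Hom B C′} {f f′ : Hom A B} →
                g ≈ g′ → f ≈ f′ → (g ∘ f) ≈ (g′ ∘ f′)

Split : ∀ {o h e} (C : CatStr o h e) → CatLaws C → CatStr (o ⊔ h ⊔ e) (h ⊔ e) e
Split C L = record
  { Obj = Idem C
  ; Hom = SplitHom C
  ; _≈_ = λ f g → SplitHom.mor f ≈ SplitHom.mor g
  ; id  = λ {X} → record { mor = Idem.idem X ; left = Idem.idem-∘ X ; right = Idem.idem-∘ X }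
  ; _∘_ = λ {X} {Y} {Z} g f → record
      { mor = SplitHom.mor g ∘ SplitHom.mor f
      ; left = ≈-trans (≈-sym (assoc (Idem.idem Z) (SplitHom.mor g) (SplitHom.mor f)))
                       (∘-cong (SplitHom.left g) (≈-refl′ (SplitHom.mor f) (SplitHom.right f)))
      ; right = ≈-trans (assoc (SplitHom.mor g) (SplitHom.mor f) (Idem.idem X))
                        (∘-cong (≈-refl′ (SplitHom.mor g) (SplitHom.left g)) (SplitHom.right f))
      }
  }
  where
  open CatStr C
  open CatLaws L
  ≈-refl′ : ∀ {A B} (x : Hom A B) {y : Hom A B} → y ≈ x → x ≈ x
  ≈-refl′ x p = ≈-trans (≈-sym p) p

JSL : Set₁
JSL = BoundedJoinSemilattice 0ℓ 0ℓ 0ℓ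

module _ (S : JSL) where
  open BoundedJoinSemilattice S

  record IsIdeal (P : Carrier → Set) : Set where
    field
      down : ∀ {a b} → a ≤ b → P b → P a
      inh  : Σ Carrier P
      dir  : ∀ {a b} → P a → P b → Σ Carrier λ c → P c × a ≤ c × b ≤ c

  UpClosed : (Carrier → Set) → Set
  UpClosed P = ∀ {a b} → a ≤ b → P a → P b

module _ (S T : JSL) where
  private
    module S = BoundedJoinSemilattice S
    module T = BoundedJoinSemilattice T

  Relation : Set₁
  Relation = S.Carrier → T.Carrier → Set

  record IsApproximable (r : Relation) : Set where
    field
      ideal : ∀ b → IsIdeal S (λ a → r a b)
      up    : ∀ a → UpClosed T (r a)

  record IsJoinApproximable (r : Relation) : Set where
    field
      approximable : IsApproximable r
      zero  : ∀ {a} → r a T.⊥ → a S.≈ S.⊥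
      join  : ∀ {a b c} → r a (b T.∨ c) →
              Σ S.Carrier λ b′ → Σ S.Carrier λ c′ →
                a S.≤ (b′ S.∨ c′) × r b′ b × r c′ c

  record JApp : Set₁ where
    field
      rel   : Relation
      isJApp : IsJoinApproximable rel

  _≈R_ : JApp → JApp → Set
  r ≈R s = ∀ a b → (JApp.rel r a b → JApp.rel s a b) × (JApp.rel s a b → JApp.rel r a b)

idJApp : (S : JSL) → JApp S S
idJApp S = record
  { rel = _≤_
  ; isJApp = record
    { approximable = record
      { ideal = λ b → record
        { down = λ p q → trans p q
        ; inh  = ⊥ , minimum b
        ; dir  = λ {a} {c} p q → (a ∨ c) , ∨-least p q , x≤x∨y a c , y≤x∨y a c }
      ; up = λ _ p q → trans q p }
    ; zero = λ p → antisym p (minimum _)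
    ; join = λ {a} {b} {c} p → b , c , p , refl , refl }
  }
  where open BoundedJoinSemilattice S

compJApp : (S T U : JSL) → JApp T U → JApp S T → JApp S U
compJApp S T U s r = record
  { rel = λ a c → Σ (BoundedJoinSemilattice.Carrier T) λ b → JApp.rel r a b × JApp.rel s b c
  ; isJApp = record
    { approximable = record
      { ideal = λ c → record
        { down = λ { p (b , arb , bsc) → b , Ir.down (Ir.ideal b) p arb , bsc }
        ; inh  = let (b , bsc) = Ir.inh (Is.ideal c) in
                 let (a , arb) = Ir.inh (Ir.ideal b) in a , b , arb , bsc
        ; dir  = λ { (b₁ , a₁rb₁ , b₁sc) (b₂ , a₂rb₂ , b₂sc) →
                   let (b₃ , b₃sc , b₁≤ , b₂≤) = Ir.dir (Is.ideal c) b₁sc b₂sc in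
                   let (a₃ , a₃rb₃ , a₁≤ , a₂≤) = Ir.dir (Ir.ideal b₃)
                         (Ir.up _ b₁≤ a₁rb₁) (Ir.up _ b₂≤ a₂rb₂) in
                   a₃ , (b₃ , a₃rb₃ , b₃sc) , a₁≤ , a₂≤ } }
      ; up = λ a p → λ { (b , arb , bsc) → b , arb , Is.up b p bsc } }
    ; zero = λ { (b , arb , bs0) →
        Jr.zero (Ir.up _ (T.reflexive (Js.zero bs0)) arb) }
    ; join = λ { (b , arb , bsjoin) →
        let (b′ , c′ , b≤ , b′sb , c′sc) = Js.join bsjoin in
        let (b″ , c″ , a≤ , b″rb′ , c″rc′) = Jr.join (Ir.up _ b≤ arb) in
        b″ , c″ , a≤ , (b′ , b″rb′ , b′sb) , (c′ , c″rc′ , c′sc) } }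
  }
  where
  module T = BoundedJoinSemilattice T
  module Jr = IsJoinApproximable (JApp.isJApp r)
  module Js = IsJoinApproximable (JApp.isJApp s)
  module Ir where
    open IsApproximable Jr.approximable public
    open IsIdeal public
  module Is = IsApproximable Js.approximable

JLatJApp : CatStr (lsuc 0ℓ) (lsuc 0ℓ) 0ℓ
JLatJApp = record
  { Obj = JSL
  ; Hom = JApp
  ; _≈_ = λ {S} {T} → _≈R_ S T
  ; id  = λ {S} → idJApp S
  ; _∘_ = λ {S} {T} {U} → compJApp S T U
  }

JLatJApp-laws : CatLaws JLatJApp
JLatJApp-laws = record
  { ≈-sym   = λ p a b → proj₂ (p a b) , proj₁ (p a b)
  ; ≈-trans = λ p q a b → (λ x → proj₁ (q a b) (proj₁ (p a b) x))
                        , (λ x → proj₂ (p a b) (proj₂ (q a b) x))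
  ; assoc   = λ k g f a d →
      (λ { (b , afb , c , bgc , ckd) → c , (b , afb , bgc) , ckd })
    , (λ { (c , (b , afb , bgc) , ckd) → b , afb , c , bgc , ckd })
  ; ∘-cong  = λ p q a c →
      (λ { (b , afb , bgc) → b , proj₁ (q a b) afb , proj₁ (p b c) bgc })
    , (λ { (b , afb , bgc) → b , proj₂ (q a b) afb , proj₂ (p b c) bgc })
  }

-- Predicative size conventions: the carrier lives in Set₁, the order and
-- equality are Set-valued (locally small), and joins exist for all
-- families indexed by a (small) type I : Set.

record ContLattice : Set₂ where
  field
    poset : Poset (lsuc 0ℓ) 0ℓ 0ℓ
  open Poset poset public
  field
    ⋁       : {I : Set} → (I → Carrier) → Carrier
    ⋁-ub    : {I : Set} (α : I → Carrier) (i : I) → α i ≤ ⋁ α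
    ⋁-least : {I : Set} (α : I → Carrier) {x : Carrier} →
              (∀ i → α i ≤ x) → ⋁ α ≤ x

  Directed : {I : Set} → (I → Carrier) → Set
  Directed {I} α = I × (∀ i j → Σ I λ k → α i ≤ α k × α j ≤ α k)

  _≪_ : Carrier → Carrier → Set₁
  x ≪ y = {I : Set} (α : I → Carrier) → Directed α → y ≤ ⋁ α →
          Σ I λ i → x ≤ α i

  field
    -- continuity, witnessed by a small basis: every element is the join
    -- of a directed family of basis elements way below it
    Basis : Set
    β     : Basis → Carrier
    approx : (x : Carrier) →
             Σ Set λ I → Σ (I → Basis) λ α →
               Directed (β ∘′ α) × (⋁ (β ∘′ α) ≈ x) × (∀ i → β (α i) ≪ x)

record SupHom (L M : ContLattice) : Set₁ where
  private
    module L = ContLattice L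
    module M = ContLattice M
  field
    fun     : L.Carrier → M.Carrier
    cong    : ∀ {x y} → x L.≈ y → fun x M.≈ fun y
    pres-⋁  : {I : Set} (α : I → L.Carrier) → fun (L.⋁ α) M.≈ M.⋁ (fun ∘′ α)

ContLat : CatStr (lsuc (lsuc 0ℓ)) (lsuc 0ℓ) (lsuc 0ℓ)
ContLat = record
  { Obj = ContLattice
  ; Hom = SupHom
  ; _≈_ = λ {L} {M} f g → ∀ x → ContLattice._≈_ M (SupHom.fun f x) (SupHom.fun g x)
  ; id  = λ {L} → record
      { fun = λ x → x ; cong = λ p → p
      ; pres-⋁ = λ α → ContLattice.Eq.refl L }
  ; _∘_ = λ {L} {M} {N} g f → record
      { fun = λ x → SupHom.fun g (SupHom.fun f x)
      ; cong = λ p → SupHom.cong g (SupHom.cong f p)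
      ; pres-⋁ = λ α → ContLattice.Eq.trans N
                   (SupHom.cong g (SupHom.pres-⋁ f α))
                   (SupHom.pres-⋁ g (λ i → SupHom.fun f (α i))) }
  }

SplitJLatJApp : CatStr (lsuc 0ℓ) (lsuc 0ℓ) 0ℓ
SplitJLatJApp = Split JLatJApp JLatJApp-laws

-- An idempotent join-approximable relation ≺ on S determines the continuous
-- lattice of its rounded ideals (a ∈ I iff a ≺ b for some b ∈ I), with basis the
-- principal ones ↡ s = {a | a ≺ s}; a split morphism acts by preimage, which
-- preserves joins precisely because it is join-approximable. Conversely, a
-- continuous lattice L yields the join-semilattice of finite joins of basis
-- elements with the way-below relation, idempotent by interpolation, and a
-- suplattice map f yields a ≪ f b. Going round, the finite join
-- ↡ s₁ ∨ … ∨ ↡ sₙ of principal ideals is ↡ (s₁ ∨ … ∨ sₙ) (join-approximability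
-- again), and x ∈ L corresponds to the ideal of finite joins way below x, whose
-- join is x again by continuity.

module Submission where

open import Data.Bool using (Bool; true; false; if_then_else_)
open import Data.Empty using () renaming (⊥ to Empty)
open import Data.Unit using (⊤; tt)
open import Data.List using (List; []; _∷_; _++_; [_])
open import Data.Product using (Σ; _×_; _,_; proj₁; proj₂)
open import Function using (_∘′_)
open import Relation.Binary.Bundles using (Poset)
open import Relation.Binary.Lattice.Bundles using (BoundedJoinSemilattice; JoinSemilattice)
import Relation.Binary.Lattice.Properties.JoinSemilattice as JoinSemilatticeProperties

open import Defs

module ContLatticeProperties (L : ContLattice) where
  open ContLattice L public

  ⊥ : Carrier
  ⊥ = ⋁ {Empty} λ ()

  ⊥-minimum : ∀ x → ⊥ ≤ x
  ⊥-minimum x = ⋁-least _ λ ()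

  infixr 6 _∨_
  _∨_ : Carrier → Carrier → Carrier
  x ∨ y = ⋁ {Bool} λ b → if b then x else y

  x≤x∨y : ∀ x y → x ≤ x ∨ y
  x≤x∨y x y = ⋁-ub _ true

  y≤x∨y : ∀ x y → y ≤ x ∨ y
  y≤x∨y x y = ⋁-ub _ false

  ∨-least : ∀ {x y z} → x ≤ z → y ≤ z → x ∨ y ≤ z
  ∨-least x≤z y≤z = ⋁-least _ λ { true → x≤z ; false → y≤z }

  joinSemilattice : JoinSemilattice _ _ _
  joinSemilattice = record
    { isJoinSemilattice = record
      { isPartialOrder = isPartialOrder
      ; supremum = λ x y → x≤x∨y x y , y≤x∨y x y , λ _ → ∨-least } }

  open JoinSemilatticeProperties joinSemilattice public using (∨-monotonic)

  ⋁-≤⋁ : ∀ {I J : Set} (α : I → Carrier) (γ : J → Carrier) →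
         (∀ i → Σ J λ j → α i ≤ γ j) → ⋁ α ≤ ⋁ γ
  ⋁-≤⋁ α γ h = ⋁-least α λ i → trans (proj₂ (h i)) (⋁-ub γ (proj₁ (h i)))

  ⋁-cong : ∀ {I : Set} (α γ : I → Carrier) → (∀ i → α i ≈ γ i) → ⋁ α ≈ ⋁ γ
  ⋁-cong α γ α≈γ = antisym (⋁-≤⋁ α γ λ i → i , reflexive (α≈γ i))
                           (⋁-≤⋁ γ α λ i → i , reflexive (Eq.sym (α≈γ i)))

  ≤-≪-trans : ∀ {x y z} → x ≤ y → y ≪ z → x ≪ z
  ≤-≪-trans x≤y y≪z α d z≤⋁α = let i , y≤αi = y≪z α d z≤⋁α in i , trans x≤y y≤αi

  ≪-≤-trans : ∀ {x y z} → x ≪ y → y ≤ z → x ≪ z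
  ≪-≤-trans x≪y y≤z α d z≤⋁α = x≪y α d (trans y≤z z≤⋁α)

  ≪⇒≤ : ∀ {x y} → x ≪ y → x ≤ y
  ≪⇒≤ {y = y} x≪y = proj₂ (x≪y {⊤} (λ _ → y) (tt , λ _ _ → tt , refl , refl) (⋁-ub _ tt))

  module _ (y : Carrier) where
    Approx : Set
    Approx = proj₁ (approx y)

    approximant : Approx → Basis
    approximant = proj₁ (proj₂ (approx y))

    approximant-directed : Directed (β ∘′ approximant)
    approximant-directed = proj₁ (proj₂ (proj₂ (approx y)))

    approximant≪ : ∀ i → β (approximant i) ≪ y
    approximant≪ = proj₂ (proj₂ (proj₂ (proj₂ (approx y))))

    y≤⋁approximant : y ≤ ⋁ (β ∘′ approximant)
    y≤⋁approximant = reflexive (Eq.sym (proj₁ (proj₂ (proj₂ (proj₂ (approx y))))))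

  -- A Set-valued version of ≪ (which quantifies over all small index types
  -- and so lives in Set₁): being below one of the chosen approximants.
  infix 4 _≪ˢ_
  _≪ˢ_ : Carrier → Carrier → Set
  x ≪ˢ y = Σ (Approx y) λ i → x ≤ β (approximant y i)

  ≪ˢ⇒≪ : ∀ {x y} → x ≪ˢ y → x ≪ y
  ≪ˢ⇒≪ {y = y} (i , x≤) = ≤-≪-trans x≤ (approximant≪ y i)

  ≪⇒≪ˢ : ∀ {x y} → x ≪ y → x ≪ˢ y
  ≪⇒≪ˢ {y = y} x≪y = x≪y _ (approximant-directed y) (y≤⋁approximant y)

  ≪ˢ⇒≤ : ∀ {x y} → x ≪ˢ y → x ≤ y
  ≪ˢ⇒≤ = ≪⇒≤ ∘′ ≪ˢ⇒≪

  ≤-≪ˢ-trans : ∀ {x y z} → x ≤ y → y ≪ˢ z → x ≪ˢ z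
  ≤-≪ˢ-trans x≤y (i , y≤) = i , trans x≤y y≤

  ≪ˢ-≤-trans : ∀ {x y z} → x ≪ˢ y → y ≤ z → x ≪ˢ z
  ≪ˢ-≤-trans x≪y y≤z = ≪⇒≪ˢ (≪-≤-trans (≪ˢ⇒≪ x≪y) y≤z)

  ⊥≪ˢ : ∀ y → ⊥ ≪ˢ y
  ⊥≪ˢ y = proj₁ (approximant-directed y) , ⊥-minimum _

  ∨-≪ˢ : ∀ {x x′ y} → x ≪ˢ y → x′ ≪ˢ y → x ∨ x′ ≪ˢ y
  ∨-≪ˢ {y = y} (i , x≤) (j , x′≤) =
    let k , i≤k , j≤k = proj₂ (approximant-directed y) i j
    in k , ∨-least (trans x≤ i≤k) (trans x′≤ j≤k)

  -- z is the directed join of the approximants of its approximants, so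
  -- anything way below z lies below one of those.
  interpolate : ∀ {x z} → x ≪ z → Σ Basis λ c → x ≪ β c × β c ≪ z
  interpolate {x} {z} x≪z =
    let (i , j) , x≤ = x≪z γ γ-directed z≤⋁γ
    in approximant z i , ≤-≪-trans x≤ (approximant≪ _ j) , approximant≪ z i
    where
    J : Set
    J = Σ (Approx z) λ i → Approx (β (approximant z i))

    γ : J → Carrier
    γ (i , j) = β (approximant (β (approximant z i)) j)

    γ-directed : Directed γ
    γ-directed = (i₀ , proj₁ (approximant-directed _)) , upper
      where
      i₀ = proj₁ (approximant-directed z)
      upper : ∀ a b → Σ J λ c → γ a ≤ γ c × γ b ≤ γ c
      upper (i , j) (i′ , j′) =
        let k , i≤k , i′≤k = proj₂ (approximant-directed z) i i′
            l , j≤l = ≪⇒≪ˢ (≪-≤-trans (approximant≪ _ j) i≤k)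
            l′ , j′≤l′ = ≪⇒≪ˢ (≪-≤-trans (approximant≪ _ j′) i′≤k)
            m , l≤m , l′≤m = proj₂ (approximant-directed _) l l′
        in (k , m) , trans j≤l l≤m , trans j′≤l′ l′≤m

    z≤⋁γ : z ≤ ⋁ γ
    z≤⋁γ = trans (y≤⋁approximant z) (⋁-least _ λ i →
             trans (y≤⋁approximant _) (⋁-least _ λ j → ⋁-ub γ (i , j)))

  interpolateˢ : ∀ {x z} → x ≪ˢ z → Σ Basis λ c → x ≪ˢ β c × β c ≪ˢ z
  interpolateˢ x≪z = let c , x≪c , c≪z = interpolate (≪ˢ⇒≪ x≪z) in c , ≪⇒≪ˢ x≪c , ≪⇒≪ˢ c≪z

  -- The pairwise joins of approximants of y and z form a directed family with
  -- join y ∨ z.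
  ≪ˢ-∨-split : ∀ {a y z} → a ≪ˢ y ∨ z →
               Σ (Approx y) λ i → Σ (Approx z) λ j → a ≤ β (approximant y i) ∨ β (approximant z j)
  ≪ˢ-∨-split {a} {y} {z} a≪ =
    let (i , j) , a≤ = ≪ˢ⇒≪ a≪ γ γ-directed y∨z≤⋁γ in i , j , a≤
    where
    γ : Approx y × Approx z → Carrier
    γ (i , j) = β (approximant y i) ∨ β (approximant z j)

    γ-directed : Directed γ
    γ-directed = (proj₁ (approximant-directed y) , proj₁ (approximant-directed z)) , λ
      { (i , j) (i′ , j′) →
        let k , i≤k , i′≤k = proj₂ (approximant-directed y) i i′
            l , j≤l , j′≤l = proj₂ (approximant-directed z) j j′
        in (k , l) , ∨-monotonic i≤k j≤l , ∨-monotonic i′≤k j′≤l }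

    y∨z≤⋁γ : y ∨ z ≤ ⋁ γ
    y∨z≤⋁γ = ∨-least
      (trans (y≤⋁approximant y) (⋁-least _ λ i →
        trans (x≤x∨y _ _) (⋁-ub γ (i , proj₁ (approximant-directed z)))))
      (trans (y≤⋁approximant z) (⋁-least _ λ j →
        trans (y≤x∨y _ _) (⋁-ub γ (proj₁ (approximant-directed y) , j))))

  ⟦_⟧ : List Basis → Carrier
  ⟦ [] ⟧ = ⊥
  ⟦ b ∷ bs ⟧ = β b ∨ ⟦ bs ⟧

  ⟦++⟧≤∨ : ∀ xs ys → ⟦ xs ++ ys ⟧ ≤ ⟦ xs ⟧ ∨ ⟦ ys ⟧
  ⟦++⟧≤∨ [] ys = y≤x∨y _ _
  ⟦++⟧≤∨ (x ∷ xs) ys = ∨-least (trans (x≤x∨y _ _) (x≤x∨y _ _))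
    (trans (⟦++⟧≤∨ xs ys) (∨-monotonic (y≤x∨y _ _) refl))

  ∨≤⟦++⟧ : ∀ xs ys → ⟦ xs ⟧ ∨ ⟦ ys ⟧ ≤ ⟦ xs ++ ys ⟧
  ∨≤⟦++⟧ [] ys = ∨-least (⊥-minimum _) refl
  ∨≤⟦++⟧ (x ∷ xs) ys = ∨-least (∨-monotonic refl (trans (x≤x∨y _ _) (∨≤⟦++⟧ xs ys)))
    (trans (trans (y≤x∨y _ _) (∨≤⟦++⟧ xs ys)) (y≤x∨y _ _))

  β≤⟦[]⟧ : ∀ b → β b ≤ ⟦ [ b ] ⟧
  β≤⟦[]⟧ b = x≤x∨y _ _

  ⟦[]⟧≤β : ∀ b → ⟦ [ b ] ⟧ ≤ β b
  ⟦[]⟧≤β b = ∨-least refl (⊥-minimum _)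

  ⟦[approximant]⟧≪ˢ : ∀ y i → ⟦ [ approximant y i ] ⟧ ≪ˢ y
  ⟦[approximant]⟧≪ˢ y i = i , ⟦[]⟧≤β _

  interpolateˢ-[] : ∀ {x z} → x ≪ˢ z → Σ Basis λ c → x ≪ˢ ⟦ [ c ] ⟧ × ⟦ [ c ] ⟧ ≪ˢ z
  interpolateˢ-[] x≪z =
    let c , x≪c , c≪z = interpolateˢ x≪z
    in c , ≪ˢ-≤-trans x≪c (β≤⟦[]⟧ c) , ≤-≪ˢ-trans (⟦[]⟧≤β c) c≪z

module SupHomProperties {L M : ContLattice} (f : SupHom L M) where
  private
    module L = ContLatticeProperties L
    module M = ContLatticeProperties M
  open SupHom f public

  pres-∨ : ∀ x y → fun (x L.∨ y) M.≈ fun x M.∨ fun y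
  pres-∨ x y = M.Eq.trans (pres-⋁ _) (M.⋁-cong _ _ λ { true → M.Eq.refl ; false → M.Eq.refl })

  pres-⊥ : fun L.⊥ M.≤ M.⊥
  pres-⊥ = M.trans (M.reflexive (pres-⋁ _)) (M.⋁-least _ λ ())

  mono : ∀ {x y} → x L.≤ y → fun x M.≤ fun y
  mono {x} {y} x≤y = M.trans (M.x≤x∨y (fun x) (fun y))
    (M.trans (M.reflexive (M.Eq.sym (pres-∨ x y)))
      (M.reflexive (cong (L.antisym (L.∨-least x≤y L.refl) (L.y≤x∨y x y)))))

  -- f y is the directed join of the images of the approximants of y.
  ≪ˢ-image : ∀ {a y} → a M.≪ˢ fun y → Σ (L.Approx y) λ i → a M.≪ˢ fun (L.β (L.approximant y i))
  ≪ˢ-image {a} {y} a≪ =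
    let c , a≪c , c≪ = M.interpolateˢ a≪
        i , c≤ = M.≪ˢ⇒≪ c≪ γ γ-directed fy≤⋁γ
    in i , M.≪ˢ-≤-trans a≪c c≤
    where
    γ : L.Approx y → M.Carrier
    γ i = fun (L.β (L.approximant y i))
    γ-directed : M.Directed γ
    γ-directed = proj₁ (L.approximant-directed y) , λ i j →
      let k , i≤k , j≤k = proj₂ (L.approximant-directed y) i j in k , mono i≤k , mono j≤k
    fy≤⋁γ : fun y M.≤ M.⋁ γ
    fy≤⋁γ = M.trans (mono (L.y≤⋁approximant y)) (M.reflexive (pres-⋁ _))

  ≪ˢ-image-[] : ∀ {a y} → a M.≪ˢ fun y →
                Σ L.Basis λ u → a M.≪ˢ fun L.⟦ [ u ] ⟧ × L.⟦ [ u ] ⟧ L.≪ˢ y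
  ≪ˢ-image-[] {y = y} a≪ =
    let i , a≪′ = ≪ˢ-image a≪
        u = L.approximant y i
    in u , M.≪ˢ-≤-trans a≪′ (mono (L.β≤⟦[]⟧ u)) , L.⟦[approximant]⟧≪ˢ y i

  ≪ˢ-image-trans : ∀ {a x y} → a M.≪ˢ fun x → x L.≪ˢ y → a M.≪ˢ fun y
  ≪ˢ-image-trans a≪ x≪y = M.≪ˢ-≤-trans a≪ (mono (L.≪ˢ⇒≤ x≪y))

module JSLProperties (S : JSL) where
  open BoundedJoinSemilattice S public
  open JoinSemilatticeProperties joinSemilattice public using (∨-monotonic)

  ⨆ : {E : Set} → (E → Carrier) → List E → Carrier
  ⨆ g [] = ⊥
  ⨆ g (e ∷ es) = g e ∨ ⨆ g es

  ⨆-++ : ∀ {E} (g : E → Carrier) xs ys → ⨆ g xs ∨ ⨆ g ys ≤ ⨆ g (xs ++ ys)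
  ⨆-++ g [] ys = ∨-least (minimum _) refl
  ⨆-++ g (x ∷ xs) ys =
    ∨-least (∨-monotonic refl (trans (x≤x∨y _ _) (⨆-++ g xs ys)))
            (trans (trans (y≤x∨y _ _) (⨆-++ g xs ys)) (y≤x∨y _ _))

  ⨆-++ˡ : ∀ {E} (g : E → Carrier) xs ys → ⨆ g xs ≤ ⨆ g (xs ++ ys)
  ⨆-++ˡ g xs ys = trans (x≤x∨y _ _) (⨆-++ g xs ys)

  ⨆-++ʳ : ∀ {E} (g : E → Carrier) xs ys → ⨆ g ys ≤ ⨆ g (xs ++ ys)
  ⨆-++ʳ g xs ys = trans (y≤x∨y _ _) (⨆-++ g xs ys)

  module Ideal {P : Carrier → Set} (I : IsIdeal S P) where
    open IsIdeal I public

    ⊥∈ : P ⊥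
    ⊥∈ = down (minimum _) (proj₂ inh)

    ∨∈ : ∀ {a b} → P a → P b → P (a ∨ b)
    ∨∈ a∈ b∈ = let c , c∈ , a≤c , b≤c = dir a∈ b∈ in down (∨-least a≤c b≤c) c∈

module JAppProperties {S T : JSL} (h : JApp S T) where
  private
    module S = JSLProperties S
    module T = JSLProperties T
  open JApp h public
  open IsJoinApproximable isJApp public
  open IsApproximable approximable public hiding (up)

  up : ∀ {a b b′} → b T.≤ b′ → rel a b → rel a b′
  up = IsApproximable.up approximable _

  down : ∀ {a a′ b} → a S.≤ a′ → rel a′ b → rel a b
  down = IsIdeal.down (ideal _)

  ⊥-rel : ∀ b → rel S.⊥ b
  ⊥-rel b = S.Ideal.⊥∈ (ideal b)

  ∨-rel : ∀ {a a′ b b′} → rel a b → rel a′ b′ → rel (a S.∨ a′) (b T.∨ b′)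
  ∨-rel {b = b} {b′ = b′} p q =
    S.Ideal.∨∈ (ideal _) (up (T.x≤x∨y b b′) p) (up (T.y≤x∨y b b′) q)

module RoundedIdeals (X : Idem JLatJApp) where
  S : JSL
  S = Idem.obj X
  module S = JSLProperties S
  module R = JAppProperties (Idem.idem X)

  infix 4 _≺_
  _≺_ : S.Carrier → S.Carrier → Set
  _≺_ = R.rel

  ≺≺⇒≺ : ∀ {a m b} → a ≺ m → m ≺ b → a ≺ b
  ≺≺⇒≺ a≺m m≺b = proj₁ (Idem.idem-∘ X _ _) (_ , a≺m , m≺b)

  ≺⇒≺≺ : ∀ {a b} → a ≺ b → Σ S.Carrier λ m → a ≺ m × m ≺ b
  ≺⇒≺≺ = proj₂ (Idem.idem-∘ X _ _)

  record RoundedIdeal : Set₁ where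
    field
      P        : S.Carrier → Set
      isIdeal  : IsIdeal S P
      rounded  : ∀ {a} → P a → Σ S.Carrier λ b → P b × a ≺ b
      ≺-closed : ∀ {a b} → a ≺ b → P b → P a
    module I = S.Ideal isIdeal
  open RoundedIdeal public

  infix 4 _⊆_ _≋_
  _⊆_ : RoundedIdeal → RoundedIdeal → Set
  I ⊆ J = ∀ a → P I a → P J a

  _≋_ : RoundedIdeal → RoundedIdeal → Set
  I ≋ J = I ⊆ J × J ⊆ I

  poset : Poset _ _ _
  poset = record
    { Carrier = RoundedIdeal ; _≈_ = _≋_ ; _≤_ = _⊆_
    ; isPartialOrder = record
      { isPreorder = record
        { isEquivalence = record
          { refl = (λ _ p → p) , (λ _ p → p)
          ; sym = λ (I⊆J , J⊆I) → J⊆I , I⊆J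
          ; trans = λ (I⊆J , J⊆I) (J⊆K , K⊆J) →
              (λ a p → J⊆K a (I⊆J a p)) , (λ a p → J⊆I a (K⊆J a p)) }
        ; reflexive = proj₁
        ; trans = λ I⊆J J⊆K a p → J⊆K a (I⊆J a p) }
      ; antisym = _,_ } }

  Member : {I : Set} → (I → RoundedIdeal) → Set
  Member {I} α = Σ I λ i → Σ S.Carrier (P (α i))

  element : ∀ {I} (α : I → RoundedIdeal) → Member α → S.Carrier
  element α (_ , a , _) = a

  sup : {I : Set} → (I → RoundedIdeal) → RoundedIdeal
  sup α = record
    { P = λ a → Σ (List (Member α)) λ xs → a ≺ S.⨆ (element α) xs
    ; isIdeal = record
      { down = λ { a≤b (xs , b≺) → xs , R.down a≤b b≺ }
      ; inh = S.⊥ , [] , R.⊥-rel S.⊥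
      ; dir = λ { (xs , a≺) (ys , b≺) →
          let c , c≺ , a≤c , b≤c = IsIdeal.dir (R.ideal _)
                (R.up (S.⨆-++ˡ (element α) xs ys) a≺)
                (R.up (S.⨆-++ʳ (element α) xs ys) b≺)
          in c , (xs ++ ys , c≺) , a≤c , b≤c } }
    ; rounded = λ { (xs , a≺) → let m , a≺m , m≺ = ≺⇒≺≺ a≺ in m , (xs , m≺) , a≺m }
    ; ≺-closed = λ { a≺b (xs , b≺) → xs , ≺≺⇒≺ a≺b b≺ } }

  sup-upper : {I : Set} (α : I → RoundedIdeal) (i : I) → α i ⊆ sup α
  sup-upper α i a a∈ = let b , b∈ , a≺b = rounded (α i) a∈ in
    [ i , b , b∈ ] , R.up (S.x≤x∨y b S.⊥) a≺b

  ⨆-∈-upper-bound : ∀ {I} (α : I → RoundedIdeal) {J : RoundedIdeal} → (∀ i → α i ⊆ J) →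
             ∀ xs → P J (S.⨆ (element α) xs)
  ⨆-∈-upper-bound α {J} α⊆J [] = I.⊥∈ J
  ⨆-∈-upper-bound α {J} α⊆J ((i , b , b∈) ∷ xs) = I.∨∈ J (α⊆J i b b∈) (⨆-∈-upper-bound α {J} α⊆J xs)

  sup-least : {I : Set} (α : I → RoundedIdeal) {J : RoundedIdeal} → (∀ i → α i ⊆ J) → sup α ⊆ J
  sup-least α {J} α⊆J a (xs , a≺) = ≺-closed J a≺ (⨆-∈-upper-bound α {J} α⊆J xs)

  ↡ : S.Carrier → RoundedIdeal
  ↡ s = record
    { P = _≺ s
    ; isIdeal = R.ideal s
    ; rounded = λ a≺s → let m , a≺m , m≺s = ≺⇒≺≺ a≺s in m , m≺s , a≺m
    ; ≺-closed = ≺≺⇒≺ }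

  ↡-mono : ∀ {a b} → a S.≤ b → ↡ a ⊆ ↡ b
  ↡-mono a≤b _ c≺a = R.up a≤b c≺a

  ↡-≺ : ∀ {a b} → a ≺ b → ↡ a ⊆ ↡ b
  ↡-≺ a≺b _ c≺a = ≺≺⇒≺ c≺a a≺b

  Directed : {I : Set} → (I → RoundedIdeal) → Set
  Directed {I} α = I × (∀ i j → Σ I λ k → α i ⊆ α k × α j ⊆ α k)

  ⨆-∈-directed : ∀ {I} (α : I → RoundedIdeal) → Directed α →
                      ∀ xs → Σ I λ k → P (α k) (S.⨆ (element α) xs)
  ⨆-∈-directed α (i₀ , _) [] = i₀ , I.⊥∈ (α i₀)
  ⨆-∈-directed α d@(_ , upper) ((i , b , b∈) ∷ xs) =
    let k , ⨆∈ = ⨆-∈-directed α d xs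
        k′ , i⊆k′ , k⊆k′ = upper i k
    in k′ , I.∨∈ (α k′) (i⊆k′ b b∈) (k⊆k′ _ ⨆∈)

  ↡-way-below : ∀ J s → P J s → {I : Set} (α : I → RoundedIdeal) →
                Directed α → J ⊆ sup α → Σ I λ i → ↡ s ⊆ α i
  ↡-way-below J s s∈ α d J⊆ =
    let xs , s≺ = J⊆ s s∈
        k , ⨆∈ = ⨆-∈-directed α d xs
    in k , λ a a≺s → ≺-closed (α k) a≺s (≺-closed (α k) s≺ ⨆∈)

  members : RoundedIdeal → Set
  members J = Σ S.Carrier (P J)

  ↡-member : ∀ J → members J → RoundedIdeal
  ↡-member J (s , _) = ↡ s

  ↡-members-directed : ∀ J → Directed (↡-member J)
  ↡-members-directed J = IsIdeal.inh (isIdeal J) , λ { (s , s∈) (t , t∈) →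
    let c , c∈ , s≤c , t≤c = IsIdeal.dir (isIdeal J) s∈ t∈ in
    (c , c∈) , ↡-mono s≤c , ↡-mono t≤c }

  sup-↡-members : ∀ J → sup (↡-member J) ≋ J
  sup-↡-members J =
      sup-least (↡-member J) {J} (λ { (s , s∈) a a≺s → ≺-closed J a≺s s∈ })
    , λ a a∈ → let b , b∈ , a≺b = rounded J a∈ in sup-upper (↡-member J) (b , b∈) a a≺b

  lattice : ContLattice
  lattice .ContLattice.poset = poset
  lattice .ContLattice.⋁ = sup
  lattice .ContLattice.⋁-ub = sup-upper
  lattice .ContLattice.⋁-least = sup-least
  lattice .ContLattice.Basis = S.Carrier
  lattice .ContLattice.β = ↡
  lattice .ContLattice.approx J =
    members J , proj₁ , ↡-members-directed J , sup-↡-members J , λ { (s , s∈) → ↡-way-below J s s∈ }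

module Preimage {X Y : Idem JLatJApp} (h : SplitHom JLatJApp X Y) where
  private
    module X = RoundedIdeals X
    module Y = RoundedIdeals Y
    module H = JAppProperties (SplitHom.mor h)
  open H using (rel)

  rel≺⇒rel : ∀ {a m c} → rel a m → m Y.≺ c → rel a c
  rel≺⇒rel p q = proj₁ (SplitHom.left h _ _) (_ , p , q)

  rel⇒rel≺ : ∀ {a c} → rel a c → Σ Y.S.Carrier λ m → rel a m × m Y.≺ c
  rel⇒rel≺ = proj₂ (SplitHom.left h _ _)

  ≺rel⇒rel : ∀ {a m c} → a X.≺ m → rel m c → rel a c
  ≺rel⇒rel p q = proj₁ (SplitHom.right h _ _) (_ , p , q)

  rel⇒≺rel : ∀ {a c} → rel a c → Σ X.S.Carrier λ m → a X.≺ m × rel m c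
  rel⇒≺rel = proj₂ (SplitHom.right h _ _)

  preimage : Y.RoundedIdeal → X.RoundedIdeal
  preimage J = record
    { P = λ a → Σ Y.S.Carrier λ b → Y.P J b × rel a b
    ; isIdeal = record
      { down = λ { a≤a′ (b , b∈ , a′b) → b , b∈ , H.down a≤a′ a′b }
      ; inh = let b , b∈ = IsIdeal.inh (Y.isIdeal J)
                  a , ab = IsIdeal.inh (H.ideal b) in a , b , b∈ , ab
      ; dir = λ { (b , b∈ , ab) (b′ , b′∈ , a′b′) →
          let c , c∈ , b≤c , b′≤c = IsIdeal.dir (Y.isIdeal J) b∈ b′∈
              d , dc , a≤d , a′≤d = IsIdeal.dir (H.ideal c) (H.up b≤c ab) (H.up b′≤c a′b′)
          in d , (c , c∈ , dc) , a≤d , a′≤d } }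
    ; rounded = λ { (b , b∈ , ab) → let m , a≺m , mb = rel⇒≺rel ab in m , (b , b∈ , mb) , a≺m }
    ; ≺-closed = λ { a≺a′ (b , b∈ , a′b) → b , b∈ , ≺rel⇒rel a≺a′ a′b } }

  module _ {I : Set} (α : I → Y.RoundedIdeal) where
    preimage-member : Set
    preimage-member = X.Member (preimage ∘′ α)

    -- Join-approximability of h is exactly what lets a join on the right be
    -- split into joins on the left.
    split-⨆ : ∀ {m} (ys : List (Y.Member α)) → rel m (Y.S.⨆ (Y.element α) ys) →
              Σ (List preimage-member) λ xs → m X.S.≤ X.S.⨆ (X.element (preimage ∘′ α)) xs
    split-⨆ [] m0 = [] , X.S.reflexive (H.zero m0)
    split-⨆ ((i , y , y∈) ∷ ys) m∨ =
      let b′ , c′ , m≤ , b′y , c′ys = H.join m∨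
          xs , c′≤ = split-⨆ ys c′ys
      in (i , b′ , y , y∈ , b′y) ∷ xs , X.S.trans m≤ (X.S.∨-monotonic X.S.refl c′≤)

    image-⨆ : (xs : List preimage-member) →
              Σ (List (Y.Member α)) λ ys →
                rel (X.S.⨆ (X.element (preimage ∘′ α)) xs) (Y.S.⨆ (Y.element α) ys)
    image-⨆ [] = [] , H.⊥-rel _
    image-⨆ ((i , x , y , y∈ , xy) ∷ xs) =
      let ys , p = image-⨆ xs in (i , y , y∈) ∷ ys , H.∨-rel xy p

    preimage-sup : preimage (Y.sup α) X.≋ X.sup (preimage ∘′ α)
    preimage-sup =
        (λ { a (b , (ys , b≺) , ab) →
             let m , a≺m , m⨆ = rel⇒≺rel (rel≺⇒rel ab b≺)
                 xs , m≤ = split-⨆ ys m⨆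
             in xs , X.R.up m≤ a≺m })
      , (λ { a (xs , a≺) →
             let ys , ⨆rel = image-⨆ xs
                 m , am , m≺ = rel⇒rel≺ (≺rel⇒rel a≺ ⨆rel)
             in m , (ys , m≺) , am })

  supHom : SupHom Y.lattice X.lattice
  supHom = record
    { fun = preimage
    ; cong = λ { (J⊆K , K⊆J) → (λ { a (b , b∈ , ab) → b , J⊆K b b∈ , ab })
                             , (λ { a (b , b∈ , ab) → b , K⊆J b b∈ , ab }) }
    ; pres-⋁ = preimage-sup }

roundedIdealsFunctor : Functor SplitJLatJApp (Op ContLat)
roundedIdealsFunctor = record
  { F₀ = RoundedIdeals.lattice
  ; F₁ = Preimage.supHom
  ; F-resp-≈ = λ f≈g J →
      (λ { a (b , b∈ , fab) → b , b∈ , proj₁ (f≈g a b) fab })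
    , (λ { a (b , b∈ , gab) → b , b∈ , proj₂ (f≈g a b) gab })
  ; F-id = λ {X} J → (λ { a (b , b∈ , a≺b) → RoundedIdeals.≺-closed J a≺b b∈ })
                   , (λ a a∈ → RoundedIdeals.rounded J a∈)
  ; F-∘ = λ g f J →
      (λ { a (c , c∈ , b , fab , gbc) → b , (c , c∈ , gbc) , fab })
    , (λ { a (b , (c , c∈ , gbc) , fab) → c , c∈ , b , fab , gbc })
  }

module _ (L : ContLattice) where
  open ContLatticeProperties L

  -- Finite joins of basis elements, presented as lists (avoiding a quotient)
  -- and compared through their joins in L.
  basisListJSL : JSL
  basisListJSL = record
    { Carrier = List Basis
    ; _≈_ = λ xs ys → ⟦ xs ⟧ ≈ ⟦ ys ⟧
    ; _≤_ = λ xs ys → ⟦ xs ⟧ ≤ ⟦ ys ⟧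
    ; _∨_ = _++_
    ; ⊥ = []
    ; isBoundedJoinSemilattice = record
      { isJoinSemilattice = record
        { isPartialOrder = record
          { isPreorder = record
            { isEquivalence = record { refl = Eq.refl ; sym = Eq.sym ; trans = Eq.trans }
            ; reflexive = reflexive ; trans = trans }
          ; antisym = antisym }
        ; supremum = λ xs ys → trans (x≤x∨y _ _) (∨≤⟦++⟧ xs ys)
                             , trans (y≤x∨y _ _) (∨≤⟦++⟧ xs ys)
                             , λ _ xs≤ ys≤ → trans (⟦++⟧≤∨ xs ys) (∨-least xs≤ ys≤) }
      ; minimum = λ _ → ⊥-minimum _ } }

  ≪ˢ-isIdeal : ∀ x → IsIdeal basisListJSL λ xs → ⟦ xs ⟧ ≪ˢ x
  ≪ˢ-isIdeal x = record
    { down = ≤-≪ˢ-trans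
    ; inh = [] , ⊥≪ˢ x
    ; dir = λ {a} {b} a≪ b≪ → a ++ b
        , ≤-≪ˢ-trans (⟦++⟧≤∨ a b) (∨-≪ˢ a≪ b≪)
        , trans (x≤x∨y _ _) (∨≤⟦++⟧ a b)
        , trans (y≤x∨y _ _) (∨≤⟦++⟧ a b) }

module _ {L M : ContLattice} (f : SupHom M L) where
  open ContLatticeProperties L
  private module M = ContLatticeProperties M
  open SupHomProperties f

  wayBelowRel : List Basis → List M.Basis → Set
  wayBelowRel a b = ⟦ a ⟧ ≪ˢ fun M.⟦ b ⟧

  -- Proofs inside these objects are kept opaque: otherwise checking that two
  -- of them are convertible unfolds the proofs, which is prohibitively slow.
  opaque
    wayBelowRel-isJoinApproximable :
      IsJoinApproximable (basisListJSL L) (basisListJSL M) wayBelowRel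
    wayBelowRel-isJoinApproximable = record
      { approximable = record
        { ideal = λ b → ≪ˢ-isIdeal L (fun M.⟦ b ⟧)
        ; up = λ _ b≤b′ a≪ → ≪ˢ-≤-trans a≪ (mono b≤b′) }
      ; zero = λ a≪ → antisym (trans (≪ˢ⇒≤ a≪) pres-⊥) (⊥-minimum _)
      ; join = λ {a} {b} {c} a≪ →
          let a≪∨ = ≪ˢ-≤-trans a≪ (trans (mono (M.⟦++⟧≤∨ b c)) (reflexive (pres-∨ _ _)))
              i , j , a≤ = ≪ˢ-∨-split a≪∨
              u = approximant (fun M.⟦ b ⟧) i
              v = approximant (fun M.⟦ c ⟧) j
          in [ u ] , [ v ]
             , trans a≤ (trans (∨-monotonic (β≤⟦[]⟧ u) (β≤⟦[]⟧ v)) (∨≤⟦++⟧ [ u ] [ v ]))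
             , ⟦[approximant]⟧≪ˢ _ i
             , ⟦[approximant]⟧≪ˢ _ j }

  wayBelowJApp : JApp (basisListJSL L) (basisListJSL M)
  wayBelowJApp = record { rel = wayBelowRel ; isJApp = wayBelowRel-isJoinApproximable }

module _ (L : ContLattice) where
  open ContLatticeProperties L hiding (_≈_)
  open CatStr JLatJApp using (_≈_; _∘_)

  opaque
    wayBelowJApp-idempotent :
      wayBelowJApp (CatStr.id ContLat {L}) ∘ wayBelowJApp (CatStr.id ContLat {L})
      ≈ wayBelowJApp (CatStr.id ContLat {L})
    wayBelowJApp-idempotent a b =
        (λ { (m , a≪m , m≪b) → ≪ˢ-≤-trans a≪m (≪ˢ⇒≤ m≪b) })
      , (λ a≪b → let c , a≪c , c≪b = interpolateˢ-[] a≪b in [ c ] , a≪c , c≪b)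

  wayBelowIdem : Idem JLatJApp
  wayBelowIdem = record
    { obj = basisListJSL L
    ; idem = wayBelowJApp (CatStr.id ContLat {L})
    ; idem-∘ = wayBelowJApp-idempotent }

wayBelowSplitHom : ∀ {L M} → SupHom M L → SplitHom JLatJApp (wayBelowIdem L) (wayBelowIdem M)
wayBelowSplitHom {L} f = record
  { mor = wayBelowJApp f
  ; left = λ a b →
      (λ { (m , a≪fm , m≪b) → ≪ˢ-image-trans a≪fm m≪b })
    , (λ a≪fb → let u , a≪u , u≪ = ≪ˢ-image-[] a≪fb in [ u ] , a≪u , u≪)
  ; right = λ a b →
      (λ { (m , a≪m , m≪fb) → ≤-≪ˢ-trans (≪ˢ⇒≤ a≪m) m≪fb })
    , (λ a≪fb → let c , a≪c , c≪fb = interpolateˢ-[] a≪fb in [ c ] , a≪c , c≪fb) }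
  where
  open ContLatticeProperties L
  open SupHomProperties f

wayBelowFunctor : Functor (Op ContLat) SplitJLatJApp
wayBelowFunctor = record
  { F₀ = wayBelowIdem
  ; F₁ = wayBelowSplitHom
  ; F-resp-≈ = λ {L} f≈g a b → let open ContLatticeProperties L in
        (λ a≪ → ≪ˢ-≤-trans a≪ (reflexive (f≈g _)))
      , (λ a≪ → ≪ˢ-≤-trans a≪ (reflexive (Eq.sym (f≈g _))))
  ; F-id = λ a b → (λ a≪ → a≪) , (λ a≪ → a≪)
  ; F-∘ = λ g f a c → let open SupHomProperties f in
        (λ a≪ → let u , a≪u , u≪ = ≪ˢ-image-[] a≪ in [ u ] , a≪u , u≪)
      , (λ { (b , a≪fb , b≪) → ≪ˢ-image-trans a≪fb b≪ })
  }

module Unit (X : Idem JLatJApp) where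
  open RoundedIdeals X
  module FX = ContLatticeProperties lattice

  ⨆⟨_⟩ : List S.Carrier → S.Carrier
  ⨆⟨_⟩ = S.⨆ (λ s → s)

  ⟦⟧⊆↡⨆ : ∀ xs → FX.⟦ xs ⟧ ⊆ ↡ ⨆⟨ xs ⟩
  ⟦⟧⊆↡⨆ [] _ ([] , a≺) = a≺
  ⟦⟧⊆↡⨆ [] _ (((() , _) ∷ _) , _)
  ⟦⟧⊆↡⨆ (x ∷ xs) = FX.∨-least {↡ x} {FX.⟦ xs ⟧} {↡ ⨆⟨ x ∷ xs ⟩}
    (↡-mono (S.x≤x∨y _ _)) (λ a a∈ → R.up (S.y≤x∨y x _) (⟦⟧⊆↡⨆ xs a a∈))

  ↡⨆⊆⟦⟧ : ∀ xs → ↡ ⨆⟨ xs ⟩ ⊆ FX.⟦ xs ⟧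
  ↡⨆⊆⟦⟧ [] _ a≺ = [] , a≺
  ↡⨆⊆⟦⟧ (x ∷ xs) a a≺ =
    let b′ , c′ , a≤ , b′≺x , c′≺ = R.join a≺
        K = FX.⟦ x ∷ xs ⟧
    in IsIdeal.down (isIdeal K) a≤
         (I.∨∈ K (FX.x≤x∨y (↡ x) _ b′ b′≺x) (FX.y≤x∨y (↡ x) _ c′ (↡⨆⊆⟦⟧ xs c′ c′≺)))

  GFX : Idem JLatJApp
  GFX = wayBelowIdem lattice

  collapse : JApp (Idem.obj GFX) S
  collapse = record
    { rel = λ xs s → Σ S.Carrier λ t → t ≺ s × FX.⟦ xs ⟧ ⊆ ↡ t
    ; isJApp = record
      { approximable = record
        { ideal = λ s → record
          { down = λ { xs⊆ys (t , t≺s , ys⊆t) → t , t≺s , λ a a∈ → ys⊆t a (xs⊆ys a a∈) }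
          ; inh = let t , t≺s = IsIdeal.inh (R.ideal s) in
                  [] , t , t≺s , FX.⊥-minimum (↡ t)
          ; dir = λ { {xs} {ys} (t , t≺s , xs⊆t) (t′ , t′≺s , ys⊆t′) →
              let u , u≺s , t≤u , t′≤u = IsIdeal.dir (R.ideal s) t≺s t′≺s
                  xs∨ys⊆u = FX.∨-least {FX.⟦ xs ⟧} {FX.⟦ ys ⟧} {↡ u}
                    (λ a a∈ → ↡-mono t≤u a (xs⊆t a a∈))
                    (λ a a∈ → ↡-mono t′≤u a (ys⊆t′ a a∈))
              in xs ++ ys
               , (u , u≺s , λ a a∈ → xs∨ys⊆u a (FX.⟦++⟧≤∨ xs ys a a∈))
               , (λ a a∈ → FX.∨≤⟦++⟧ xs ys a (FX.x≤x∨y FX.⟦ xs ⟧ _ a a∈))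
               , (λ a a∈ → FX.∨≤⟦++⟧ xs ys a (FX.y≤x∨y FX.⟦ xs ⟧ _ a a∈)) } }
        ; up = λ _ s≤s′ (t , t≺s , xs⊆t) → t , R.up s≤s′ t≺s , xs⊆t }
      ; zero = λ { {xs} (t , t≺⊥ , xs⊆t) →
          (λ a a∈ → ↡⨆⊆⟦⟧ [] a (R.up (S.reflexive (R.zero t≺⊥)) (xs⊆t a a∈)))
          , FX.⊥-minimum FX.⟦ xs ⟧ }
      ; join = λ { (t , t≺b∨c , xs⊆t) →
          let b′ , c′ , t≤ , b′≺b , c′≺c = R.join t≺b∨c
              mb , b′≺mb , mb≺b = ≺⇒≺≺ b′≺b
              mc , c′≺mc , mc≺c = ≺⇒≺≺ c′≺c
          in [ b′ ] , [ c′ ]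
             , (λ a a∈ → ↡⨆⊆⟦⟧ (b′ ∷ c′ ∷ []) a
                  (R.up (S.∨-monotonic S.refl (S.x≤x∨y _ _)) (R.up t≤ (xs⊆t a a∈))))
             , (mb , mb≺b , λ a a∈ → ↡-≺ b′≺mb a (FX.⟦[]⟧≤β b′ a a∈))
             , (mc , mc≺c , λ a a∈ → ↡-≺ c′≺mc a (FX.⟦[]⟧≤β c′ a a∈)) } } }

  expand : JApp S (Idem.obj GFX)
  expand = record
    { rel = λ s xs → P FX.⟦ xs ⟧ s
    ; isJApp = record
      { approximable = record
        { ideal = λ xs → isIdeal FX.⟦ xs ⟧
        ; up = λ s xs⊆ys s∈ → xs⊆ys s s∈ }
      ; zero = λ s∈ → R.zero (⟦⟧⊆↡⨆ [] _ s∈)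
      ; join = λ { {s} {b} {c} s∈ →
          let b∨c⊆ = FX.∨-least {FX.⟦ b ⟧} {FX.⟦ c ⟧} {↡ (⨆⟨ b ⟩ S.∨ ⨆⟨ c ⟩)}
                       (λ a a∈ → R.up (S.x≤x∨y _ _) (⟦⟧⊆↡⨆ b a a∈))
                       (λ a a∈ → R.up (S.y≤x∨y _ _) (⟦⟧⊆↡⨆ c a a∈))
              b′ , c′ , s≤ , b′≺ , c′≺ = R.join (b∨c⊆ s (FX.⟦++⟧≤∨ b c s s∈))
          in b′ , c′ , s≤ , ↡⨆⊆⟦⟧ b b′ b′≺ , ↡⨆⊆⟦⟧ c c′ c′≺ } } }

  ⟦[]⟧⊆↡ : ∀ {a b} → a ≺ b → FX.⟦ [ a ] ⟧ ⊆ ↡ b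
  ⟦[]⟧⊆↡ a≺b c c∈ = ↡-≺ a≺b c (FX.⟦[]⟧≤β _ c c∈)

  collapseSplitHom : SplitHom JLatJApp GFX X
  collapseSplitHom = record
    { mor = collapse
    ; left = λ xs s →
        (λ { (m , (t , t≺m , xs⊆t) , m≺s) → t , ≺≺⇒≺ t≺m m≺s , xs⊆t })
      , (λ { (t , t≺s , xs⊆t) → let m , t≺m , m≺s = ≺⇒≺≺ t≺s in m , (t , t≺m , xs⊆t) , m≺s })
    ; right = λ xs s →
        (λ { (ms , xs≪ms , (t , t≺s , ms⊆t)) → t , t≺s , λ a a∈ → ms⊆t a (FX.≪ˢ⇒≤ {FX.⟦ xs ⟧} {FX.⟦ ms ⟧} xs≪ms a a∈) })
      , (λ { (t , t≺s , xs⊆t) →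
          let m₁ , t≺m₁ , m₁≺s = ≺⇒≺≺ t≺s
              m₂ , m₁≺m₂ , m₂≺s = ≺⇒≺≺ m₁≺s
          in [ m₁ ] , FX.≪ˢ-≤-trans {FX.⟦ xs ⟧} {↡ m₁} {FX.⟦ [ m₁ ] ⟧} ((t , t≺m₁) , xs⊆t) (FX.β≤⟦[]⟧ m₁)
                    , (m₂ , m₂≺s , ⟦[]⟧⊆↡ m₁≺m₂) }) }

  expandSplitHom : SplitHom JLatJApp X GFX
  expandSplitHom = record
    { mor = expand
    ; left = λ s xs →
        (λ { (ms , s∈ , ms≪xs) → FX.≪ˢ⇒≤ {FX.⟦ ms ⟧} {FX.⟦ xs ⟧} ms≪xs s s∈ })
      , (λ s∈ → let t , t∈ , s≺t = rounded FX.⟦ xs ⟧ s∈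
                    u , u∈ , t≺u = rounded FX.⟦ xs ⟧ t∈
                in [ t ] , FX.β≤⟦[]⟧ t s s≺t , ((u , u∈) , ⟦[]⟧⊆↡ t≺u))
    ; right = λ s xs →
        (λ { (m , s≺m , m∈) → ≺-closed FX.⟦ xs ⟧ s≺m m∈ })
      , (λ s∈ → let b , b∈ , s≺b = rounded FX.⟦ xs ⟧ s∈ in b , s≺b , b∈) }

  open CatStr JLatJApp using (_≈_; _∘_)

  collapse∘expand≈id : collapse ∘ expand ≈ Idem.idem X
  collapse∘expand≈id s s′ =
      (λ { (xs , s∈ , (t , t≺s′ , xs⊆t)) → ≺≺⇒≺ (xs⊆t s s∈) t≺s′ })
    , (λ s≺s′ → let m₁ , s≺m₁ , m₁≺s′ = ≺⇒≺≺ s≺s′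
                    m₂ , m₁≺m₂ , m₂≺s′ = ≺⇒≺≺ m₁≺s′
                in [ m₁ ] , FX.β≤⟦[]⟧ m₁ s s≺m₁ , (m₂ , m₂≺s′ , ⟦[]⟧⊆↡ m₁≺m₂))

  expand∘collapse≈id : expand ∘ collapse ≈ Idem.idem GFX
  expand∘collapse≈id xs ys =
      (λ { (s , (t , t≺s , xs⊆t) , s∈) → (t , ≺-closed FX.⟦ ys ⟧ t≺s s∈) , xs⊆t })
    , (λ { ((u , u∈) , xs⊆u) → let u′ , u′∈ , u≺u′ = rounded FX.⟦ ys ⟧ u∈ in
             u′ , (u , u≺u′ , xs⊆u) , u′∈ })

collapse-natural : ∀ {X Y} (f : SplitHom JLatJApp X Y) →
  let open CatStr JLatJApp using (_≈_; _∘_) in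
  SplitHom.mor f ∘ Unit.collapse X ≈ Unit.collapse Y ∘ wayBelowJApp (Preimage.supHom f)
collapse-natural {X} {Y} f xs y =
    (λ { (s , (t , t≺s , xs⊆t) , fsy) →
         let m₀ , fsm₀ , m₀≺y = rel⇒rel≺ fsy
             m′ , m₀≺m′ , m′≺y = Y.≺⇒≺≺ m₀≺y
             b , ftb , b≺m₀ = rel⇒rel≺ (≺rel⇒rel t≺s fsm₀)
         in [ m₀ ] , ((t , b , FY.β≤⟦[]⟧ m₀ b b≺m₀ , ftb) , xs⊆t)
            , (m′ , m′≺y , UY.⟦[]⟧⊆↡ m₀≺m′) })
  , (λ { (ys , ((a , b , b∈ , fab) , xs⊆a) , (t′ , t′≺y , ys⊆t′)) →
         let s , a≺s , fsy = rel⇒≺rel (rel≺⇒rel (rel≺⇒rel fab (ys⊆t′ b b∈)) t′≺y)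
         in s , (a , a≺s , xs⊆a) , fsy })
  where
  module Y = RoundedIdeals Y
  module UY = Unit Y
  module FY = UY.FX
  open Preimage f

unit : CompIsoId roundedIdealsFunctor wayBelowFunctor
unit = record
  { η = Unit.collapseSplitHom
  ; η⁻¹ = Unit.expandSplitHom
  ; iso₁ = Unit.collapse∘expand≈id
  ; iso₂ = Unit.expand∘collapse≈id
  ; natural = collapse-natural
  }

module Counit (L : ContLattice) where
  module L = ContLatticeProperties L
  open RoundedIdeals (wayBelowIdem L)

  wayBelowIdeal : L.Carrier → RoundedIdeal
  wayBelowIdeal x = record
    { P = λ xs → L.⟦ xs ⟧ L.≪ˢ x
    ; isIdeal = ≪ˢ-isIdeal L x
    ; rounded = λ a≪x → let c , a≪c , c≪x = L.interpolateˢ-[] a≪x in [ c ] , c≪x , a≪c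
    ; ≺-closed = λ a≪b b≪x → L.≤-≪ˢ-trans (L.≪ˢ⇒≤ a≪b) b≪x }

  module _ {I : Set} (α : I → L.Carrier) where
    private
      γ : List (Member (wayBelowIdeal ∘′ α)) → L.Carrier
      γ es = L.⟦ S.⨆ (element (wayBelowIdeal ∘′ α)) es ⟧

      γ-directed : L.Directed γ
      γ-directed = [] , λ es es′ → es ++ es′
        , S.⨆-++ˡ _ es es′ , S.⨆-++ʳ _ es es′

      ⋁α≤⋁γ : L.⋁ α L.≤ L.⋁ γ
      ⋁α≤⋁γ = L.⋁-least α λ i → L.trans (L.y≤⋁approximant (α i)) (L.⋁-least _ λ j →
        let u = L.approximant (α i) j in
        L.trans (L.β≤⟦[]⟧ u) (L.⋁-ub γ [ i , [ u ] , L.⟦[approximant]⟧≪ˢ (α i) j ]))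

      γ≤⋁α : ∀ es → γ es L.≤ L.⋁ α
      γ≤⋁α [] = L.⊥-minimum _
      γ≤⋁α ((i , ys , ys≪) ∷ es) = L.trans (L.⟦++⟧≤∨ ys _)
        (L.∨-least (L.trans (L.≪ˢ⇒≤ ys≪) (L.⋁-ub α i)) (γ≤⋁α es))

    wayBelowIdeal-⋁ : wayBelowIdeal (L.⋁ α) ≋ sup (wayBelowIdeal ∘′ α)
    wayBelowIdeal-⋁ =
        (λ xs xs≪ → let c , xs≪c , c≪ = L.interpolateˢ xs≪
                        es , c≤ = L.≪-≤-trans (L.≪ˢ⇒≪ c≪) ⋁α≤⋁γ γ γ-directed L.refl
                    in es , L.≪ˢ-≤-trans xs≪c c≤)
      , (λ { xs (es , xs≪) → L.≪ˢ-≤-trans xs≪ (γ≤⋁α es) })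

  wayBelowIdealSupHom : SupHom L lattice
  wayBelowIdealSupHom = record
    { fun = wayBelowIdeal
    ; cong = λ x≈y → (λ xs xs≪x → L.≪ˢ-≤-trans xs≪x (L.reflexive x≈y))
                   , (λ xs xs≪y → L.≪ˢ-≤-trans xs≪y (L.reflexive (L.Eq.sym x≈y)))
    ; pres-⋁ = wayBelowIdeal-⋁ }

  memberJoin : (K : RoundedIdeal) → members K → L.Carrier
  memberJoin K (xs , _) = L.⟦ xs ⟧

  idealJoin : RoundedIdeal → L.Carrier
  idealJoin K = L.⋁ (memberJoin K)

  module _ {I : Set} (α : I → RoundedIdeal) where
    private
      ⟦⨆⟧≤⋁ : ∀ es → L.⟦ S.⨆ (element α) es ⟧ L.≤ L.⋁ (idealJoin ∘′ α)
      ⟦⨆⟧≤⋁ [] = L.⊥-minimum _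
      ⟦⨆⟧≤⋁ ((i , ys , ys∈) ∷ es) = L.trans (L.⟦++⟧≤∨ ys _)
        (L.∨-least (L.trans (L.⋁-ub (memberJoin (α i)) (ys , ys∈)) (L.⋁-ub (idealJoin ∘′ α) i))
                   (⟦⨆⟧≤⋁ es))

    idealJoin-sup : idealJoin (sup α) L.≈ L.⋁ (idealJoin ∘′ α)
    idealJoin-sup = L.antisym
      (L.⋁-least _ λ { (xs , (es , xs≪)) → L.trans (L.≪ˢ⇒≤ xs≪) (⟦⨆⟧≤⋁ es) })
      (L.⋁-least _ λ i → L.⋁-least _ λ { (ys , ys∈) →
        L.⋁-ub (memberJoin (sup α)) (ys , sup-upper α i ys ys∈) })

  idealJoinSupHom : SupHom lattice L
  idealJoinSupHom = record
    { fun = idealJoin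
    ; cong = λ { {K} {K′} (K⊆K′ , K′⊆K) → L.antisym
        (L.⋁-≤⋁ (memberJoin K) (memberJoin K′) λ (xs , xs∈) → (xs , K⊆K′ xs xs∈) , L.refl)
        (L.⋁-≤⋁ (memberJoin K′) (memberJoin K) λ (xs , xs∈) → (xs , K′⊆K xs xs∈) , L.refl) }
    ; pres-⋁ = idealJoin-sup }

  idealJoin-wayBelowIdeal : ∀ x → idealJoin (wayBelowIdeal x) L.≈ x
  idealJoin-wayBelowIdeal x = L.antisym
    (L.⋁-least _ λ (xs , xs≪x) → L.≪ˢ⇒≤ xs≪x)
    (L.trans (L.y≤⋁approximant x) (L.⋁-least _ λ i → let u = L.approximant x i in
      L.trans (L.β≤⟦[]⟧ u) (L.⋁-ub (memberJoin (wayBelowIdeal x)) ([ u ] , L.⟦[approximant]⟧≪ˢ x i))))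

  wayBelowIdeal-idealJoin : ∀ K → wayBelowIdeal (idealJoin K) ≋ K
  wayBelowIdeal-idealJoin K =
      (λ xs xs≪ → let c , xs≪c , c≪ = L.interpolateˢ xs≪
                      (ys , ys∈) , c≤ = L.≪ˢ⇒≪ c≪ (memberJoin K) members-directed L.refl
                  in ≺-closed K (L.≪ˢ-≤-trans xs≪c c≤) ys∈)
    , (λ xs xs∈ → let ys , ys∈ , xs≪ys = rounded K xs∈ in
        L.≪ˢ-≤-trans xs≪ys (L.⋁-ub (memberJoin K) (ys , ys∈)))
    where
    members-directed : L.Directed (memberJoin K)
    members-directed = IsIdeal.inh (isIdeal K) , λ (a , a∈) (b , b∈) →
      let c , c∈ , a≤c , b≤c = IsIdeal.dir (isIdeal K) a∈ b∈ in (c , c∈) , a≤c , b≤c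

wayBelowIdeal-natural : ∀ {L M} (f : SupHom L M) y →
  RoundedIdeals._≋_ (wayBelowIdem M)
    (Counit.wayBelowIdeal M (SupHom.fun f y))
    (Preimage.preimage (wayBelowSplitHom f) (Counit.wayBelowIdeal L y))
wayBelowIdeal-natural f y =
    (λ xs xs≪ → let u , xs≪u , u≪y = ≪ˢ-image-[] xs≪ in [ u ] , u≪y , xs≪u)
  , (λ { xs (ys , ys≪y , xs≪fys) → ≪ˢ-image-trans xs≪fys ys≪y })
  where open SupHomProperties f

counit : CompIsoId wayBelowFunctor roundedIdealsFunctor
counit = record
  { η = Counit.wayBelowIdealSupHom
  ; η⁻¹ = Counit.idealJoinSupHom
  ; iso₁ = Counit.idealJoin-wayBelowIdeal
  ; iso₂ = Counit.wayBelowIdeal-idealJoin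
  ; natural = wayBelowIdeal-natural
  }

theorem3p18 : Equivalence SplitJLatJApp (Op ContLat)
theorem3p18 = record
  { F = roundedIdealsFunctor
  ; G = wayBelowFunctor
  ; unit = unit
  ; count = counit
  }
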